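{- Let $\mathcal{P}$ be a nice Roman domination property, let $G=(V,E)$ be a graph and $A\subseteq V$. Then $C_{\mathcal{P},G}[A]\neq\emptyset$ if and only if there is a function $g:V\to\{0,1,2\}$ that is minimal with property $\mathcal{P}$ on $G$ and satisfies $2\cdot\chi_A+\chi_{V\setminus N[A]}\le g$. Furthermore, for all $h\in C_{\mathcal{P},G}[A]$, $2\cdot\chi_A+\chi_{V\setminus N[A]}\le h$.
   Context: Graphs are finite, simple and undirected. $N(v)$, $N[v]=N(v)\cup\{v\}$ are the open/closed neighborhoods; for $A\subseteq V$, $N[A]=\bigcup_{v\in A}N[v]$. For $A\subseteq V$ and $v\in A$, $P_{G,A}(v)=N[v]\setminus N[A\setminus\{v\}]$. For $f:V\to\{0,1,2\}$, $V_i(f)=\{v: f(v)=i\}$; $f\le g$ is pointwise; $\chi_S$ is the characteristic function of $S$. A Roman dominating function (Rdf) is an $f:V\to\{0,1,2\}$ such that each $v\in V_0(f)$ has a neighbor in $V_2(f)$. A property $\mathcal{P}$ assigns to each graph a set of functions $V\to\{0,1,2\}$; $f$ is minimal with property $\mathcal{P}$ if it has $\mathcal{P}$ and no $g\le f$, $g\neq f$, has $\mathcal{P}$. $\mathcal{P}$ is a nice Roman domination property if for every graph $G=(V,E)$ and every $f$ with property $\mathcal{P}$: (1) $f$ is an Rdf; (2) for all $v\in V_0(f)$, $f+\chi_{\{v\}}$ has $\mathcal{P}$; (3) for all $v\in V_2(f)$, $f-\chi_{\{v\}}$ has $\mathcal{P}$ iff $P_{G[V\setminus V_1(f)],V_2(f)}(v)\subseteq\{v\}$.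 $C_{\mathcal{P},G}[A]$ is the set of functions $f:V\to\{0,1,2\}$ that are minimal with property $\mathcal{P}$ on $G$ and have $V_2(f)=A$. -}

module Defs where

open import Data.Nat using (ℕ; _≤_; _*_; _+_)
open import Data.Bool using (Bool; true; false; _∧_; _∨_; if_then_else_)
open import Data.Fin using (Fin; zero; suc; toℕ; _≟_)
import Data.Fin as F
open import Data.Fin.Subset using (Subset; _∈_; _⊆_; _∩_; ∁; _-_; ⁅_⁆)
open import Data.Vec using (tabulate; lookup)
open import Data.Product using (Σ; ∃; _×_; _,_)
open import Relation.Nullary.Decidable using (does)
open import Relation.Binary.PropositionalEquality using (_≡_)
open import Function.Bundles using (_⇔_)

record Graph : Set where
  field
    n      : ℕ
    adj    : Fin n → Fin n → Bool
    sym    : ∀ u v → adj u v ≡ adj v u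
    irrefl : ∀ v → adj v v ≡ false
open Graph public

V : Graph → Set
V G = Fin (n G)

RFun : Graph → Set
RFun G = V G → Fin 3

anyF : ∀ {m} → (Fin m → Bool) → Bool
anyF {ℕ.zero}  p = false
anyF {ℕ.suc m} p = p zero ∨ anyF (λ i → p (suc i))

Nc : (G : Graph) → V G → Subset (n G)
Nc G v = tabulate (λ u → does (u ≟ v) ∨ adj G u v)

NcA : (G : Graph) → Subset (n G) → Subset (n G)
NcA G A = tabulate (λ u → anyF (λ a → lookup A a ∧ lookup (Nc G a) u))

-- Neighbourhoods in the induced subgraph G[W] (for vertices of W),
-- expressed on the ambient vertex set: N_{G[W]}[v] = N_G[v] ∩ W.
NcIn : (G : Graph) → Subset (n G) → V G → Subset (n G)
NcIn G W v = Nc G v ∩ W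

NcAIn : (G : Graph) → Subset (n G) → Subset (n G) → Subset (n G)
NcAIn G W A = tabulate (λ u → anyF (λ a → lookup A a ∧ lookup (NcIn G W a) u))

PrivIn : (G : Graph) → Subset (n G) → Subset (n G) → V G → Subset (n G)
PrivIn G W A v = NcIn G W v ∩ ∁ (NcAIn G W (A - v))

χ : ∀ {m} → Subset m → Fin m → ℕ
χ S v = if lookup S v then 1 else 0

Vof : (G : Graph) → RFun G → Fin 3 → Subset (n G)
Vof G f i = tabulate (λ v → does (f v ≟ i))

_≤f_ : ∀ {G : Graph} → RFun G → RFun G → Set
_≤f_ {G} f g = ∀ v → f v F.≤ g v

-- f with the value at v replaced by 1  (= f + χ_{v} if f v = 0, f - χ_{v} if f v = 2)
set1 : (G : Graph) → RFun G → V G → RFun G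
set1 G f v u = if does (u ≟ v) then F.suc F.zero else f u

IsRdf : (G : Graph) → RFun G → Set
IsRdf G f = ∀ v → f v ≡ zero → ∃ λ u → adj G v u ≡ true × f u ≡ suc (suc zero)

Property : Set₁
Property = (G : Graph) → RFun G → Set

record IsNice (𝒫 : Property) : Set where
  field
    rdf  : ∀ G f → 𝒫 G f → IsRdf G f
    up   : ∀ G f → 𝒫 G f → ∀ v → f v ≡ zero → 𝒫 G (set1 G f v)
    down : ∀ G f → 𝒫 G f → ∀ v → f v ≡ suc (suc zero) →
           𝒫 G (set1 G f v) ⇔
           (PrivIn G (∁ (Vof G f (suc zero))) (Vof G f (suc (suc zero))) v ⊆ ⁅ v ⁆)

Minimal : Property → (G : Graph) → RFun G → Set
Minimal 𝒫 G f = 𝒫 G f × (∀ g → _≤f_ {G} g f → 𝒫 G g → ∀ v → g v ≡ f v)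

InC : Property → (G : Graph) → Subset (n G) → RFun G → Set
InC 𝒫 G A f = Minimal 𝒫 G f × (∀ v → (f v ≡ suc (suc zero)) ⇔ (v ∈ A))

LowerBd : (G : Graph) → Subset (n G) → RFun G → Set
LowerBd G A g = ∀ v → 2 * χ A v + χ (∁ (NcA G A)) v ≤ toℕ (g v)

-- A minimal g with 2·χ_A + χ_{V∖N[A]} ≤ g has A ⊆ V₂(g) and V₀(g) ⊆ N[A]. If some
-- v ∉ A had g(v) = 2, every other vertex w of G[V ∖ V₁(g)] would lie in the
-- closed neighbourhood of V₂(g) ∖ {v} there: either g(w) = 2, or g(w) = 0 and w is
-- dominated by some a ∈ A ⊆ V₂(g). So v has no private neighbour besides itself,
-- niceness lets us lower g(v) to 1, and minimality is violated; hence V₂(g) = A.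
-- Conversely every h ∈ C[A] satisfies the bound: a vertex with h = 0 has a
-- neighbour with h = 2, which lies in A.
module Submission where

open import Defs hiding (sym)
open import Data.Bool using (Bool; true; false; _∧_; _∨_)
open import Data.Empty using (⊥-elim)
open import Data.Fin using (Fin; zero; suc; toℕ; _≟_)
open import Data.Fin.Properties using (≤-refl)
open import Data.Fin.Subset using (Subset; _∈_; _∉_; _⊆_; ∁; _-_; ⁅_⁆)
open import Data.Fin.Subset.Properties
  using (_∈?_; x∈⁅x⁆; x∈p∩q⁺; x∈p∩q⁻; x∈∁p⇒x∉p; x∈p⇒x∉∁p; x∉p⇒x∈∁p; x∈p∧x≢y⇒x∈p-y)
open import Data.Nat using (ℕ; _≤_; z≤n; s≤s; _*_; _+_)
open import Data.Nat.Properties using (≤-trans; m+n≤o⇒m≤o; m+n≤o⇒n≤o)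
open import Data.Product using (∃; _×_; _,_; proj₁)
open import Data.Vec using (tabulate; lookup)
open import Data.Vec.Properties using (lookup∘tabulate; []=⇒lookup; lookup⇒[]=)
open import Function.Bundles using (_⇔_; mk⇔; Equivalence)
open import Relation.Binary.PropositionalEquality using (_≡_; _≢_; refl; sym; trans; cong; module ≡-Reasoning)
open import Relation.Nullary using (¬_; yes; no)
open import Relation.Nullary.Decidable using (does; dec-true)

one two : Fin 3
one = suc zero
two = suc (suc zero)

two≢one : two ≢ one
two≢one ()

2≤⇒≡two : (x : Fin 3) → 2 ≤ toℕ x → x ≡ two
2≤⇒≡two (suc (suc zero)) _ = refl
2≤⇒≡two (suc zero) (s≤s ())

anyF⁺ : ∀ {m} (p : Fin m → Bool) i → p i ≡ true → anyF p ≡ true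
anyF⁺ p zero    pi rewrite pi = refl
anyF⁺ p (suc i) pi with p zero
... | true  = refl
... | false = anyF⁺ (λ j → p (suc j)) i pi

anyF⁻ : ∀ {m} (p : Fin m → Bool) → anyF p ≡ true → ∃ λ i → p i ≡ true
anyF⁻ {ℕ.suc _} p any with p zero in p0
... | true  = zero , p0
... | false with anyF⁻ (λ j → p (suc j)) any
...   | i , pi = suc i , pi

∈-tabulate⁺ : ∀ {m} {p : Fin m → Bool} {x} → p x ≡ true → x ∈ tabulate p
∈-tabulate⁺ {p = p} {x} px = lookup⇒[]= x _ (trans (lookup∘tabulate p x) px)

∈-tabulate⁻ : ∀ {m} {p : Fin m → Bool} {x} → x ∈ tabulate p → p x ≡ true
∈-tabulate⁻ {p = p} {x} x∈ = trans (sym (lookup∘tabulate p x)) ([]=⇒lookup x∈)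

∧-true : ∀ {a b} → a ≡ true → b ≡ true → a ∧ b ≡ true
∧-true refl refl = refl

χ-∈ : ∀ {m} {S : Subset m} {x} → x ∈ S → χ S x ≡ 1
χ-∈ x∈S rewrite []=⇒lookup x∈S = refl

χ≤1 : ∀ {m} (S : Subset m) x → χ S x ≤ 1
χ≤1 S x with lookup S x
... | true  = s≤s z≤n
... | false = z≤n

χ-∉ : ∀ {m} {S : Subset m} {x} → x ∉ S → χ S x ≡ 0
χ-∉ {S = S} {x} x∉S with lookup S x in Sx
... | true  = ⊥-elim (x∉S (lookup⇒[]= x S Sx))
... | false = refl

module _ {G : Graph} where

  ∈Vof⁺ : ∀ {f : RFun G} {i x} → f x ≡ i → x ∈ Vof G f i
  ∈Vof⁺ {f} {i} {x} fx = ∈-tabulate⁺ (dec-true (f x ≟ i) fx)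

  ∈Nc-self : ∀ v → v ∈ Nc G v
  ∈Nc-self v = ∈-tabulate⁺ (cong (_∨ adj G v v) (dec-true (v ≟ v) refl))

  ∈Nc-adj : ∀ {u v} → adj G v u ≡ true → v ∈ Nc G u
  ∈Nc-adj {u} {v} vu = ∈-tabulate⁺ (∨-true (does (v ≟ u)) vu)
    where
    ∨-true : ∀ a {b} → b ≡ true → a ∨ b ≡ true
    ∨-true true  _ = refl
    ∨-true false b = b

  ∈NcA⁺ : ∀ {A : Subset (n G)} {a w} → a ∈ A → w ∈ Nc G a → w ∈ NcA G A
  ∈NcA⁺ {a = a} a∈A w∈N =
    ∈-tabulate⁺ (anyF⁺ _ a (∧-true ([]=⇒lookup a∈A) ([]=⇒lookup w∈N)))

  ∈NcA⁻ : ∀ {A : Subset (n G)} {w} → w ∈ NcA G A → ∃ λ a → a ∈ A × w ∈ Nc G a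
  ∈NcA⁻ {A} {w} w∈ with anyF⁻ _ (∈-tabulate⁻ w∈)
  ... | a , Aa∧Naw with lookup A a in Aa | lookup (Nc G a) w in Naw
  ...   | true | true = a , lookup⇒[]= a A Aa , lookup⇒[]= w (Nc G a) Naw

  ∈NcAIn⁺ : ∀ {W A : Subset (n G)} {a w} → a ∈ A → w ∈ NcIn G W a → w ∈ NcAIn G W A
  ∈NcAIn⁺ {a = a} a∈A w∈N =
    ∈-tabulate⁺ (anyF⁺ _ a (∧-true ([]=⇒lookup a∈A) ([]=⇒lookup w∈N)))

  LowerBd⇔ : ∀ {A : Subset (n G)} {g : RFun G} →
             LowerBd G A g ⇔ ((∀ a → a ∈ A → g a ≡ two) × (∀ w → g w ≡ zero → w ∈ NcA G A))
  LowerBd⇔ {A} {g} = mk⇔ (λ lb → A⊆V₂ lb , V₀⊆NA lb) (λ (A⊆V₂ , V₀⊆NA) → bound A⊆V₂ V₀⊆NA)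
    where
    A⊆V₂ : LowerBd G A g → ∀ a → a ∈ A → g a ≡ two
    A⊆V₂ lb a a∈A with lb a
    ... | bd rewrite χ-∈ a∈A = 2≤⇒≡two (g a) (m+n≤o⇒m≤o 2 bd)

    V₀⊆NA : LowerBd G A g → ∀ w → g w ≡ zero → w ∈ NcA G A
    V₀⊆NA lb w gw with w ∈? NcA G A | lb w
    ... | yes w∈NA | _  = w∈NA
    ... | no w∉NA  | bd rewrite gw | χ-∈ (x∉p⇒x∈∁p w∉NA) with () ← m+n≤o⇒n≤o (2 * χ A w) bd

    bound : (∀ a → a ∈ A → g a ≡ two) → (∀ w → g w ≡ zero → w ∈ NcA G A) →
            ∀ v → 2 * χ A v + χ (∁ (NcA G A)) v ≤ toℕ (g v)
    bound A⊆V₂ V₀⊆NA v with v ∈? A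
    ... | yes v∈A rewrite χ-∈ v∈A | A⊆V₂ v v∈A
                        | χ-∉ (x∈p⇒x∉∁p (∈NcA⁺ v∈A (∈Nc-self v))) = s≤s (s≤s z≤n)
    ... | no v∉A rewrite χ-∉ v∉A with g v in gv
    ...   | zero  rewrite χ-∉ (x∈p⇒x∉∁p (V₀⊆NA v gv)) = z≤n
    ...   | suc _ = ≤-trans (χ≤1 (∁ (NcA G A)) v) (s≤s z≤n)

  set1-self : ∀ (f : RFun G) v → set1 G f v v ≡ one
  set1-self f v rewrite dec-true (v ≟ v) refl = refl

  set1≤f : ∀ {f : RFun G} {v} → f v ≡ two → _≤f_ {G} (set1 G f v) f
  set1≤f {v = v} fv u with u ≟ v
  ... | yes refl rewrite fv = s≤s z≤n
  ... | no _     = ≤-refl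

  ∁V₁-v⊆NcAIn : ∀ {A : Subset (n G)} {f : RFun G} {v} →
                (∀ a → a ∈ A → f a ≡ two) → (∀ w → f w ≡ zero → w ∈ NcA G A) → v ∉ A →
                ∀ {w} → w ∈ ∁ (Vof G f one) → w ≢ v →
                w ∈ NcAIn G (∁ (Vof G f one)) (Vof G f two - v)
  ∁V₁-v⊆NcAIn {f = f} {v} A⊆V₂ V₀⊆NA v∉A {w} w∈W w≢v with f w in fw
  ... | suc (suc zero) = ∈NcAIn⁺ (x∈p∧x≢y⇒x∈p-y (∈Vof⁺ {f = f} fw) w≢v) (x∈p∩q⁺ (∈Nc-self w , w∈W))
  ... | suc zero       = ⊥-elim (x∈∁p⇒x∉p w∈W (∈Vof⁺ {f = f} fw))
  ... | zero with ∈NcA⁻ (V₀⊆NA w fw)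
  ...   | a , a∈A , w∈Na =
          ∈NcAIn⁺ (x∈p∧x≢y⇒x∈p-y (∈Vof⁺ {f = f} (A⊆V₂ a a∈A)) a≢v) (x∈p∩q⁺ (w∈Na , w∈W))
    where
    a≢v : a ≢ v
    a≢v refl = v∉A a∈A

  Priv⊆⁅self⁆ : ∀ {A : Subset (n G)} {f : RFun G} {v} →
                (∀ a → a ∈ A → f a ≡ two) → (∀ w → f w ≡ zero → w ∈ NcA G A) → v ∉ A →
                PrivIn G (∁ (Vof G f one)) (Vof G f two) v ⊆ ⁅ v ⁆
  Priv⊆⁅self⁆ {v = v} A⊆V₂ V₀⊆NA v∉A {w} w∈P with w ≟ v
  ... | yes refl = x∈⁅x⁆ v
  ... | no w≢v with x∈p∩q⁻ _ _ w∈P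
  ...   | w∈NW[v] , w∉N with x∈p∩q⁻ _ _ w∈NW[v]
  ...     | _ , w∈W = ⊥-elim (x∈∁p⇒x∉p w∉N (∁V₁-v⊆NcAIn A⊆V₂ V₀⊆NA v∉A w∈W w≢v))

  module _ {𝒫 : Property} (nice : IsNice 𝒫) where

    minimal⇒Priv⊈⁅self⁆ : ∀ {f : RFun G} {v} → Minimal 𝒫 G f → f v ≡ two →
                          ¬ (PrivIn G (∁ (Vof G f one)) (Vof G f two) v ⊆ ⁅ v ⁆)
    minimal⇒Priv⊈⁅self⁆ {f} {v} (𝒫f , minimal) fv P⊆⁅v⁆ = two≢one (begin
      two              ≡⟨ sym fv ⟩
      f v              ≡⟨ sym (minimal (set1 G f v) (set1≤f fv) 𝒫f₁ v) ⟩
      set1 G f v v     ≡⟨ set1-self f v ⟩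
      one              ∎)
      where
      open ≡-Reasoning
      𝒫f₁ : 𝒫 G (set1 G f v)
      𝒫f₁ = Equivalence.from (IsNice.down nice G f 𝒫f v fv) P⊆⁅v⁆

    minimal-LowerBd⇒V₂⊆A : ∀ {A : Subset (n G)} {g : RFun G} → Minimal 𝒫 G g → LowerBd G A g →
                           ∀ v → g v ≡ two → v ∈ A
    minimal-LowerBd⇒V₂⊆A {A} mg lb v gv with v ∈? A | Equivalence.to LowerBd⇔ lb
    ... | yes v∈A | _               = v∈A
    ... | no v∉A  | A⊆V₂ , V₀⊆NA = ⊥-elim (minimal⇒Priv⊈⁅self⁆ mg gv (Priv⊆⁅self⁆ A⊆V₂ V₀⊆NA v∉A))

    InC⇒LowerBd : ∀ {A : Subset (n G)} {h : RFun G} → InC 𝒫 G A h → LowerBd G A h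
    InC⇒LowerBd {A} {h} ((𝒫h , _) , V₂⇔A) = Equivalence.from LowerBd⇔ (A⊆V₂ , V₀⊆NA)
      where
      A⊆V₂ : ∀ a → a ∈ A → h a ≡ two
      A⊆V₂ a = Equivalence.from (V₂⇔A a)

      V₀⊆NA : ∀ w → h w ≡ zero → w ∈ NcA G A
      V₀⊆NA w hw with IsNice.rdf nice G h 𝒫h w hw
      ... | u , w~u , hu = ∈NcA⁺ (Equivalence.to (V₂⇔A u) hu) (∈Nc-adj w~u)

lemma3 : (𝒫 : Property) → IsNice 𝒫 → (G : Graph) → (A : Subset (n G)) →
         ((∃ λ f → InC 𝒫 G A f) ⇔ (∃ λ g → Minimal 𝒫 G g × LowerBd G A g))
         × (∀ h → InC 𝒫 G A h → LowerBd G A h)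
lemma3 𝒫 nice G A = mk⇔ C→bounded bounded→C , λ h → InC⇒LowerBd {G = G} nice
  where
  C→bounded : (∃ λ f → InC 𝒫 G A f) → (∃ λ g → Minimal 𝒫 G g × LowerBd G A g)
  C→bounded (f , f∈C) = f , proj₁ f∈C , InC⇒LowerBd {G = G} nice f∈C

  bounded→C : (∃ λ g → Minimal 𝒫 G g × LowerBd G A g) → (∃ λ f → InC 𝒫 G A f)
  bounded→C (g , mg , lb) =
    g , mg , λ v → mk⇔ (minimal-LowerBd⇒V₂⊆A {G = G} nice mg lb v)
                       (proj₁ (Equivalence.to (LowerBd⇔ {G = G}) lb) v)
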